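{- Let $f \colon X \to Y$ and $g \colon Y \to X$ be maps between orthosets such that $g$ is an adjoint of $f$. Then the following are equivalent: (a) $f$ is a partial orthometry and $g$ is a generalised inverse of $f$. (b) $\operatorname{im} g = (\ker f)^\perp$, $\operatorname{im} f = (\ker g)^\perp$, and the restriction of $f$ to $\operatorname{im} g$ with codomain $\operatorname{im} f$ is an orthoisomorphism between the subspaces $\operatorname{im} g$ and $\operatorname{im} f$, whose inverse is the restriction of $g$ to $\operatorname{im} f$ with codomain $\operatorname{im} g$. (c) The zero-kernel restrictions of $f$ and $g$ are mutually inverse bijections. (d) $\operatorname{im} f$ and $\operatorname{im} g$ are orthoclosed, and $f\circ g\circ f = f$ and $g\circ f\circ g = g$. In this case, the zero-kernel restriction of $f$ equals the restriction of $f$ to $\operatorname{im} g$ with codomain $\operatorname{im} f$, and the zero-kernel restriction of $g$ equals the restriction of $g$ to $\operatorname{im} f$ with codomain $\operatorname{im} g$.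
   Context: An orthoset (with $0$) is a non-empty set $X$ with a binary relation $\perp$ and element $0$ such that: $\perp$ is symmetric; $x\perp x$ iff $x=0$; $0\perp x$ for all $x$. For $A\subseteq X$, $A^\perp=\{x:x\perp y\ \forall y\in A\}$; $A$ is orthoclosed (a subspace) if $A=A^{\perp\perp}$; subspaces are orthosets with the restricted relation. $g\colon Y\to X$ is an adjoint of $f\colon X\to Y$ if $f(x)\perp y\iff x\perp g(y)$ for all $x,y$. $\ker f=\{x:f(x)=0\}$, $\operatorname{im} f=f(X)$. An orthoisomorphism is a bijection $h$ with $h(0)=0$ and $x\perp y\iff h(x)\perp h(y)$. For adjointable $f$, the zero-kernel restriction of $f$ is the map $(\ker f)^\perp\to(\operatorname{im} f)^{\perp\perp}$, $x\mapsto f(x)$. A map $f$ is a partial orthometry if it has an adjoint $g$ (called a generalised inverse of $f$) such that there exist subspaces $A$ of $X$ and $B$ of $Y$ with $A^\perp=\ker f$, $B^\perp=\ker g$, and $f$, $g$ restrict to mutually inverse orthoisomorphisms between $A$ and $B$. -}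

module Defs where

open import Level using (Level; _⊔_)
open import Data.Product using (Σ; ∃; _×_; _,_; proj₁; proj₂)
open import Relation.Binary.PropositionalEquality using (_≡_; refl; sym; subst)
open import Relation.Unary using (Pred)
open import Function.Bundles using (_⇔_; Equivalence; mk⇔)

record Orthoset (c ℓ : Level) : Set (Level.suc (c ⊔ ℓ)) where
  field
    Carrier : Set c
    _⊥_     : Carrier → Carrier → Set ℓ
    𝟘       : Carrier
    ⊥-sym   : ∀ {x y} → x ⊥ y → y ⊥ x
    ⊥-irr   : ∀ x → (x ⊥ x) ⇔ (x ≡ 𝟘)
    𝟘-⊥     : ∀ x → 𝟘 ⊥ x

open Orthoset public

private variable
  a b ℓa ℓb p q : Level

module _ (X : Orthoset a ℓa) where
  open Orthoset X renaming (Carrier to C)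

  _ᗮ : Pred C p → Pred C (a ⊔ ℓa ⊔ p)
  (A ᗮ) x = ∀ y → A y → _⊥_ X x y

  _≐_ : Pred C p → Pred C q → Set (a ⊔ p ⊔ q)
  A ≐ B = ∀ x → A x ⇔ B x

  Orthoclosed : Pred C p → Set (a ⊔ ℓa ⊔ p)
  Orthoclosed A = A ≐ ((A ᗮ) ᗮ)

  ⊆ᗮᗮ : (A : Pred C p) → ∀ x → A x → ((A ᗮ) ᗮ) x
  ⊆ᗮᗮ A x Ax y Aᗮy = ⊥-sym X (Aᗮy x Ax)

-- Orthoisomorphism between subspaces A ⊆ X and B ⊆ Y (viewed as orthosets
-- with the restricted relation; elements of Σ-types compared by underlying element).
record IsOrthoIso (X : Orthoset a ℓa) (Y : Orthoset b ℓb)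
                  (A : Pred (Carrier X) p) (B : Pred (Carrier Y) q)
                  (h : Σ (Carrier X) A → Σ (Carrier Y) B) : Set (a ⊔ b ⊔ ℓa ⊔ ℓb ⊔ p ⊔ q) where
  field
    injective  : ∀ u v → proj₁ (h u) ≡ proj₁ (h v) → proj₁ u ≡ proj₁ v
    surjective : ∀ (w : Σ (Carrier Y) B) → Σ (Σ (Carrier X) A) λ u → proj₁ (h u) ≡ proj₁ w
    pres-𝟘     : ∀ u → proj₁ u ≡ 𝟘 X → proj₁ (h u) ≡ 𝟘 Y
    pres-⊥     : ∀ u v → (_⊥_ X (proj₁ u) (proj₁ v)) ⇔ (_⊥_ Y (proj₁ (h u)) (proj₁ (h v)))

MutuallyInverse : {A : Set a} {B : Set b} {PA : Pred A p} {PB : Pred B q} →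
                  (Σ A PA → Σ B PB) → (Σ B PB → Σ A PA) → Set (a ⊔ b ⊔ p ⊔ q)
MutuallyInverse h k = (∀ u → proj₁ (k (h u)) ≡ proj₁ u) × (∀ v → proj₁ (h (k v)) ≡ proj₁ v)

module Maps (X : Orthoset a ℓa) (Y : Orthoset b ℓb) where
  private
    CX = Carrier X
    CY = Carrier Y

  IsAdjoint : (CX → CY) → (CY → CX) → Set (a ⊔ b ⊔ ℓa ⊔ ℓb)
  IsAdjoint f g = ∀ x y → (_⊥_ Y (f x) y) ⇔ (_⊥_ X x (g y))

  ker : (CX → CY) → Pred CX b
  ker f x = f x ≡ 𝟘 Y

  im : (CX → CY) → Pred CY (a ⊔ b)
  im f y = ∃ λ x → f x ≡ y

  MapsInto : (CX → CY) → Pred CX p → Pred CY q → Set (a ⊔ p ⊔ q)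
  MapsInto f A B = ∀ x → A x → B (f x)

  restrict : (f : CX → CY) (A : Pred CX p) (B : Pred CY q) →
             MapsInto f A B → Σ CX A → Σ CY B
  restrict f A B m (x , ax) = f x , m x ax

  restrictIm : (f : CX → CY) (A : Pred CX p) → Σ CX A → Σ CY (im f)
  restrictIm f A (x , _) = f x , (x , refl)

  zkr : (f : CX → CY) → Σ CX (_ᗮ X (ker f)) → Σ CY (_ᗮ Y (_ᗮ Y (im f)))
  zkr f (x , _) = f x , ⊆ᗮᗮ Y (im f) (f x) (x , refl)

  IsGeneralisedInverse : (CX → CY) → (CY → CX) → Set (Level.suc (a ⊔ b ⊔ ℓa ⊔ ℓb))
  IsGeneralisedInverse f g =
    IsAdjoint f g ×
    Σ (Pred CX (a ⊔ b ⊔ ℓa ⊔ ℓb)) λ A → Σ (Pred CY (a ⊔ b ⊔ ℓa ⊔ ℓb)) λ B →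
      Orthoclosed X A × Orthoclosed Y B ×
      _≐_ X (_ᗮ X A) (ker f) × _≐_ Y (_ᗮ Y B) (λ y → g y ≡ 𝟘 X) ×
      Σ (MapsInto f A B) λ mf → Σ (∀ y → B y → A (g y)) λ mg →
        IsOrthoIso X Y A B (restrict f A B mf) ×
        IsOrthoIso Y X B A (λ { (y , by) → g y , mg y by }) ×
        MutuallyInverse (restrict f A B mf) (λ { (y , by) → g y , mg y by })

  IsPartialOrthometry : (CX → CY) → Set (Level.suc (a ⊔ b ⊔ ℓa ⊔ ℓb))
  IsPartialOrthometry f = Σ (CY → CX) λ g → IsGeneralisedInverse f g

open Maps public

module Conditions (X : Orthoset a ℓa) (Y : Orthoset b ℓb)
                  (f : Carrier X → Carrier Y) (g : Carrier Y → Carrier X)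
                  (adj : IsAdjoint X Y f g) where

  adjᵒ : IsAdjoint Y X g f
  adjᵒ y x = mk⇔ (λ h → ⊥-sym Y (Equivalence.from (adj x y) (⊥-sym X h)))
                 (λ h → ⊥-sym X (Equivalence.to (adj x y) (⊥-sym Y h)))

  -- For an adjoint pair: (im f)^⊥⊥ ⊆ (ker g)^⊥; this identifies the codomain
  -- of the zero-kernel restriction of f with the domain of that of g.
  imᗮᗮ⊆kerᗮ : ∀ y → _ᗮ Y (_ᗮ Y (im X Y f)) y → _ᗮ Y (ker Y X g) y
  imᗮᗮ⊆kerᗮ y yᗮᗮ z gz≡0 =
    yᗮᗮ z λ w xfx → ⊥-sym Y (subst (λ t → _⊥_ Y t z) (proj₂ xfx)
      (Equivalence.from (adj (proj₁ xfx) z)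
        (subst (_⊥_ X (proj₁ xfx)) (sym gz≡0) (⊥-sym X (𝟘-⊥ X (proj₁ xfx))))))

  imᵒᗮᗮ⊆kerᗮ : ∀ x → _ᗮ X (_ᗮ X (im Y X g)) x → _ᗮ X (ker X Y f) x
  imᵒᗮᗮ⊆kerᗮ x xᗮᗮ z fz≡0 =
    xᗮᗮ z λ w ygy → ⊥-sym X (subst (λ t → _⊥_ X t z) (proj₂ ygy)
      (Equivalence.from (adjᵒ (proj₁ ygy) z)
        (subst (_⊥_ Y (proj₁ ygy)) (sym fz≡0) (⊥-sym Y (𝟘-⊥ Y (proj₁ ygy))))))

  zkrf : Σ (Carrier X) (_ᗮ X (ker X Y f)) → Σ (Carrier Y) (_ᗮ Y (ker Y X g))
  zkrf u = proj₁ (zkr X Y f u) , imᗮᗮ⊆kerᗮ (proj₁ (zkr X Y f u)) (proj₂ (zkr X Y f u))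

  zkrg : Σ (Carrier Y) (_ᗮ Y (ker Y X g)) → Σ (Carrier X) (_ᗮ X (ker X Y f))
  zkrg v = proj₁ (zkr Y X g v) , imᵒᗮᗮ⊆kerᗮ (proj₁ (zkr Y X g v)) (proj₂ (zkr Y X g v))

  CondA : Set (Level.suc (a ⊔ b ⊔ ℓa ⊔ ℓb))
  CondA = IsPartialOrthometry X Y f × IsGeneralisedInverse X Y f g

  CondB : Set (a ⊔ b ⊔ ℓa ⊔ ℓb)
  CondB = _≐_ X (im Y X g) (_ᗮ X (ker X Y f)) ×
          _≐_ Y (im X Y f) (_ᗮ Y (ker Y X g)) ×
          IsOrthoIso X Y (im Y X g) (im X Y f) (restrictIm X Y f (im Y X g)) ×
          IsOrthoIso Y X (im X Y f) (im Y X g) (restrictIm Y X g (im X Y f)) ×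
          MutuallyInverse (restrictIm X Y f (im Y X g)) (restrictIm Y X g (im X Y f))

  CondC : Set (a ⊔ b ⊔ ℓa ⊔ ℓb)
  CondC = MutuallyInverse zkrf zkrg

  CondD : Set (a ⊔ b ⊔ ℓa ⊔ ℓb)
  CondD = Orthoclosed Y (im X Y f) × Orthoclosed X (im Y X g) ×
          (∀ x → f (g (f x)) ≡ f x) × (∀ y → g (f (g y)) ≡ g y)

  -- "In this case": the zero-kernel restriction of f equals the restriction of f
  -- to im g with codomain im f (same domain, same codomain, same values); same for g.
  Coincide : Set (a ⊔ b ⊔ ℓa ⊔ ℓb)
  Coincide =
    (_≐_ X (_ᗮ X (ker X Y f)) (im Y X g) × _≐_ Y (_ᗮ Y (_ᗮ Y (im X Y f))) (im X Y f) ×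
     (∀ x (p : _ᗮ X (ker X Y f) x) (q : im Y X g x) →
        proj₁ (zkr X Y f (x , p)) ≡ proj₁ (restrictIm X Y f (im Y X g) (x , q)))) ×
    (_≐_ Y (_ᗮ Y (ker Y X g)) (im X Y f) × _≐_ X (_ᗮ X (_ᗮ X (im Y X g))) (im Y X g) ×
     (∀ y (p : _ᗮ Y (ker Y X g) y) (q : im X Y f y) →
        proj₁ (zkr Y X g (y , p)) ≡ proj₁ (restrictIm Y X g (im X Y f) (y , q))))

-- Everything reduces to one condition: g ∘ f is the identity on (ker f)ᗮ and f ∘ g is
-- the identity on (ker g)ᗮ, which is (c) unfolded. Adjointness gives (im g)ᗮ ⊆ ker f
-- (if z ⊥ g (f z) then f z ⊥ f z), hence (ker f)ᗮ = (im g)ᗮᗮ. So im g is orthoclosed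
-- exactly when im g = (ker f)ᗮ, and then g ∘ f is the identity on (ker f)ᗮ exactly when
-- g f g = g; this gives (c) ⇔ (d) ⇔ (b). On subspaces where f and g are mutually inverse,
-- x ⊥ x' ⇔ x ⊥ g (f x') ⇔ f x ⊥ f x', so the restrictions are orthoisomorphisms. For (a)
-- take A = (ker f)ᗮ and B = (ker g)ᗮ; conversely, any orthoclosed A with Aᗮ = ker f
-- contains (ker f)ᗮ.
module Submission where

open import Defs
open import Level using (Level; Lift; lift; _⊔_)
open import Data.Product using (_×_; Σ; _,_; proj₁; proj₂)
open import Function.Base using (_∘_)
open import Function.Bundles using (_⇔_; Equivalence; mk⇔)
open import Function.Properties.Equivalence using () renaming (sym to ⇔-sym; trans to ⇔-trans)
open import Relation.Binary.PropositionalEquality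
  using (_≡_; _≗_; refl; sym; trans; cong; subst; subst₂; module ≡-Reasoning)
open import Relation.Unary using (Pred; _⊆_)

open Equivalence

IdentityOn : ∀ {c p} {C : Set c} → (C → C) → Pred C p → Set (c ⊔ p)
IdentityOn h A = ∀ x → A x → h x ≡ x

module OrthosetProperties {c ℓ : Level} (Z : Orthoset c ℓ) where

  ᗮ-antitone : ∀ {p q} {A : Pred (Carrier Z) p} {B : Pred (Carrier Z) q} →
               A ⊆ B → _ᗮ Z B ⊆ _ᗮ Z A
  ᗮ-antitone A⊆B zᗮB y Ay = zᗮB y (A⊆B Ay)

  ᗮ-orthoclosed : ∀ {p} (A : Pred (Carrier Z) p) → Orthoclosed Z (_ᗮ Z A)
  ᗮ-orthoclosed A x = mk⇔ (⊆ᗮᗮ Z (_ᗮ Z A) x) (ᗮ-antitone (λ {y} → ⊆ᗮᗮ Z A y))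

  ᗮ⊆⇒ᗮ⊇ : ∀ {p q} {A : Pred (Carrier Z) p} {K : Pred (Carrier Z) q} →
          Orthoclosed Z A → _ᗮ Z A ⊆ K → _ᗮ Z K ⊆ A
  ᗮ⊆⇒ᗮ⊇ closed Aᗮ⊆K {x} xᗮK = from (closed x) (ᗮ-antitone Aᗮ⊆K xᗮK)

open OrthosetProperties

module AdjointPair {a ℓa b ℓb : Level} (X : Orthoset a ℓa) (Y : Orthoset b ℓb)
    (f : Carrier X → Carrier Y) (g : Carrier Y → Carrier X) (adj : IsAdjoint X Y f g) where
  open Conditions X Y f g adj using (adjᵒ; imᵒᗮᗮ⊆kerᗮ)
  private
    CX = Carrier X
    CY = Carrier Y
    _⊥X_ = _⊥_ X
    _⊥Y_ = _⊥_ Y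

    _ᗮˣ : ∀ {p} → Pred CX p → Pred CX (a ⊔ ℓa ⊔ p)
    A ᗮˣ = _ᗮ X A

    _ᗮʸ : ∀ {p} → Pred CY p → Pred CY (b ⊔ ℓb ⊔ p)
    B ᗮʸ = _ᗮ Y B

  f𝟘≡𝟘 : f (𝟘 X) ≡ 𝟘 Y
  f𝟘≡𝟘 = to (⊥-irr Y (f (𝟘 X))) (from (adj (𝟘 X) (f (𝟘 X))) (𝟘-⊥ X _))

  imᗮ⊆ker : (im Y X g) ᗮˣ ⊆ ker X Y f
  imᗮ⊆ker {z} zᗮim = to (⊥-irr Y (f z)) (from (adj z (f z)) (zᗮim (g (f z)) (f z , refl)))

  kerᗮ≐imᗮᗮ : _≐_ X ((ker X Y f) ᗮˣ) ((im Y X g) ᗮˣ ᗮˣ)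
  kerᗮ≐imᗮᗮ x = mk⇔ (ᗮ-antitone X imᗮ⊆ker) (imᵒᗮᗮ⊆kerᗮ x)

  orthoclosed-im⇔im≐kerᗮ : Orthoclosed X (im Y X g) ⇔ _≐_ X (im Y X g) ((ker X Y f) ᗮˣ)
  orthoclosed-im⇔im≐kerᗮ = mk⇔
    (λ closed x → ⇔-trans (closed x) (⇔-sym (kerᗮ≐imᗮᗮ x)))
    (λ im≐kerᗮ x → ⇔-trans (im≐kerᗮ x) (kerᗮ≐imᗮᗮ x))

  ⊥⇔f⊥f : ∀ {p} {A : Pred CX p} → IdentityOn (g ∘ f) A →
          ∀ x {x′} → A x′ → x ⊥X x′ ⇔ f x ⊥Y f x′
  ⊥⇔f⊥f gf≡id x {x′} Ax′ = ⇔-trans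
    (mk⇔ (subst (x ⊥X_) (sym (gf≡id x′ Ax′))) (subst (x ⊥X_) (gf≡id x′ Ax′)))
    (⇔-sym (adj x (f x′)))

  -- h is only required to act as f, so that both restrict and restrictIm qualify.
  restriction-isOrthoIso : ∀ {p q} (A : Pred CX p) (B : Pred CY q)
    {h : Σ CX A → Σ CY B} → (∀ u → proj₁ (h u) ≡ f (proj₁ u)) →
    (∀ y → B y → A (g y)) → IdentityOn (g ∘ f) A → IdentityOn (f ∘ g) B →
    IsOrthoIso X Y A B h
  restriction-isOrthoIso A B {h} h≡f g∈A gf≡id fg≡id = record
    { injective  = h-injective
    ; surjective = λ (y , By) → (g y , g∈A y By) , trans (h≡f _) (fg≡id y By)
    ; pres-𝟘     = λ u u≡𝟘 → trans (h≡f u) (trans (cong f u≡𝟘) f𝟘≡𝟘)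
    ; pres-⊥     = λ u v → ⇔-trans (⊥⇔f⊥f gf≡id (proj₁ u) (proj₂ v))
        (mk⇔ (subst₂ _⊥Y_ (sym (h≡f u)) (sym (h≡f v))) (subst₂ _⊥Y_ (h≡f u) (h≡f v)))
    }
    where
    h-injective : ∀ u v → proj₁ (h u) ≡ proj₁ (h v) → proj₁ u ≡ proj₁ v
    h-injective u@(x , Ax) v@(x′ , Ax′) hu≡hv = begin
      x          ≡⟨ sym (gf≡id x Ax) ⟩
      g (f x)    ≡⟨ cong g (trans (sym (h≡f u)) (trans hu≡hv (h≡f v))) ⟩
      g (f x′)   ≡⟨ gf≡id x′ Ax′ ⟩
      x′         ∎
      where open ≡-Reasoning

  idOn-kerᗮ⇒orthoclosed-im : IdentityOn (g ∘ f) ((ker X Y f) ᗮˣ) → Orthoclosed X (im Y X g)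
  idOn-kerᗮ⇒orthoclosed-im gf≡id x =
    mk⇔ (⊆ᗮᗮ X _ x) (λ xᗮᗮ → f x , gf≡id x (imᵒᗮᗮ⊆kerᗮ x xᗮᗮ))

  idOn-kerᗮ⇒gfg≗g : IdentityOn (g ∘ f) ((ker X Y f) ᗮˣ) → g ∘ f ∘ g ≗ g
  idOn-kerᗮ⇒gfg≗g gf≡id y = gf≡id (g y) (imᵒᗮᗮ⊆kerᗮ (g y) (⊆ᗮᗮ X _ (g y) (y , refl)))

  gfg≗g⇒idOn-im : g ∘ f ∘ g ≗ g → IdentityOn (g ∘ f) (im Y X g)
  gfg≗g⇒idOn-im gfg≗g x (y , gy≡x) = subst (λ t → g (f t) ≡ t) gy≡x (gfg≗g y)

  orthoclosed-im⇒idOn-kerᗮ : Orthoclosed X (im Y X g) → g ∘ f ∘ g ≗ g →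
                             IdentityOn (g ∘ f) ((ker X Y f) ᗮˣ)
  orthoclosed-im⇒idOn-kerᗮ closed gfg≗g x xᗮker =
    gfg≗g⇒idOn-im gfg≗g x (from (to orthoclosed-im⇔im≐kerᗮ closed x) xᗮker)

  -- ker↑ is ker g lifted to the level at which IsGeneralisedInverse takes its subspaces.
  ker↑ : Pred CY (a ⊔ ℓa)
  ker↑ y = Lift (a ⊔ ℓa) (g y ≡ 𝟘 X)

  f∈ker↑ᗮ : ∀ x → (ker↑ ᗮʸ) (f x)
  f∈ker↑ᗮ x z (lift gz≡𝟘) = from (adj x z) (subst (x ⊥X_) (sym gz≡𝟘) (⊥-sym X (𝟘-⊥ X x)))

  ker↑ᗮᗮ≐ker : _≐_ Y (ker↑ ᗮʸ ᗮʸ) (ker Y X g)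
  ker↑ᗮᗮ≐ker y = mk⇔
    (λ yᗮᗮ → to (⊥-irr X (g y)) (from (adjᵒ y (g y)) (yᗮᗮ (f (g y)) (f∈ker↑ᗮ (g y)))))
    (λ gy≡𝟘 z zᗮ → ⊥-sym Y (zᗮ y (lift gy≡𝟘)))

module Equivalences {a ℓa b ℓb : Level} (X : Orthoset a ℓa) (Y : Orthoset b ℓb)
    (f : Carrier X → Carrier Y) (g : Carrier Y → Carrier X) (adj : IsAdjoint X Y f g) where
  open Conditions X Y f g adj
  open AdjointPair X Y f g adj
  module ᵒ = AdjointPair Y X g f adjᵒ

  InverseOnKerᗮ : Set (a ⊔ ℓa ⊔ b ⊔ ℓb)
  InverseOnKerᗮ = IdentityOn (g ∘ f) (_ᗮ X (ker X Y f)) × IdentityOn (f ∘ g) (_ᗮ Y (ker Y X g))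

  C⇔inverse : CondC ⇔ InverseOnKerᗮ
  C⇔inverse = mk⇔
    (λ (gf , fg) → (λ x xᗮ → gf (x , xᗮ)) , (λ y yᗮ → fg (y , yᗮ)))
    (λ (gf , fg) → (λ (x , xᗮ) → gf x xᗮ) , (λ (y , yᗮ) → fg y yᗮ))

  D⇔inverse : CondD ⇔ InverseOnKerᗮ
  D⇔inverse = mk⇔
    (λ (closed-f , closed-g , fgf , gfg) →
      orthoclosed-im⇒idOn-kerᗮ closed-g gfg , ᵒ.orthoclosed-im⇒idOn-kerᗮ closed-f fgf)
    (λ (gf , fg) →
      ᵒ.idOn-kerᗮ⇒orthoclosed-im fg , idOn-kerᗮ⇒orthoclosed-im gf ,
      ᵒ.idOn-kerᗮ⇒gfg≗g fg , idOn-kerᗮ⇒gfg≗g gf)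

  B⇔D : CondB ⇔ CondD
  B⇔D = mk⇔
    (λ (img≐ , imf≐ , _ , _ , gf , fg) →
      from ᵒ.orthoclosed-im⇔im≐kerᗮ imf≐ , from orthoclosed-im⇔im≐kerᗮ img≐ ,
      (λ x → fg (f x , x , refl)) , (λ y → gf (g y , y , refl)))
    (λ (closed-f , closed-g , fgf , gfg) →
      to orthoclosed-im⇔im≐kerᗮ closed-g , to ᵒ.orthoclosed-im⇔im≐kerᗮ closed-f ,
      restriction-isOrthoIso (im Y X g) (im X Y f) (λ _ → refl) (λ y _ → y , refl)
        (gfg≗g⇒idOn-im gfg) (ᵒ.gfg≗g⇒idOn-im fgf) ,
      ᵒ.restriction-isOrthoIso (im X Y f) (im Y X g) (λ _ → refl) (λ x _ → x , refl)
        (ᵒ.gfg≗g⇒idOn-im fgf) (gfg≗g⇒idOn-im gfg) ,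
      (λ (x , x∈) → gfg≗g⇒idOn-im gfg x x∈) , (λ (y , y∈) → ᵒ.gfg≗g⇒idOn-im fgf y y∈))

  inverse⇒generalisedInverse : InverseOnKerᗮ → IsGeneralisedInverse X Y f g
  inverse⇒generalisedInverse (gf , fg) =
    adj , _ᗮ X ᵒ.ker↑ , _ᗮ Y ker↑ ,
    ᗮ-orthoclosed X ᵒ.ker↑ , ᗮ-orthoclosed Y ker↑ , ᵒ.ker↑ᗮᗮ≐ker , ker↑ᗮᗮ≐ker ,
    (λ x _ → f∈ker↑ᗮ x) , (λ y _ → ᵒ.f∈ker↑ᗮ y) ,
    restriction-isOrthoIso (_ᗮ X ᵒ.ker↑) (_ᗮ Y ker↑) (λ _ → refl) (λ y _ → ᵒ.f∈ker↑ᗮ y)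
      gf↑ fg↑ ,
    ᵒ.restriction-isOrthoIso (_ᗮ Y ker↑) (_ᗮ X ᵒ.ker↑) (λ _ → refl) (λ x _ → f∈ker↑ᗮ x)
      fg↑ gf↑ ,
    (λ (x , x∈) → gf↑ x x∈) , (λ (y , y∈) → fg↑ y y∈)
    where
    gf↑ : IdentityOn (g ∘ f) (_ᗮ X ᵒ.ker↑)
    gf↑ x x∈ = gf x (ᗮ-antitone X lift x∈)
    fg↑ : IdentityOn (f ∘ g) (_ᗮ Y ker↑)
    fg↑ y y∈ = fg y (ᗮ-antitone Y lift y∈)

  A⇔inverse : CondA ⇔ InverseOnKerᗮ
  A⇔inverse = mk⇔
    (λ (_ , (_ , A , B , closedA , closedB , Aᗮ≐ , Bᗮ≐ , _ , _ , _ , _ , gf , fg)) →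
      (λ x x∈ → gf (x , ᗮ⊆⇒ᗮ⊇ X closedA (to (Aᗮ≐ _)) x∈)) ,
      (λ y y∈ → fg (y , ᗮ⊆⇒ᗮ⊇ Y closedB (to (Bᗮ≐ _)) y∈)))
    (λ inverse → (g , inverse⇒generalisedInverse inverse) , inverse⇒generalisedInverse inverse)

  D⇒coincide : CondD → Coincide
  D⇒coincide (closed-f , closed-g , _) =
    ((λ x → ⇔-sym (img≐ x)) , (λ y → ⇔-sym (closed-f y)) , (λ _ _ _ → refl)) ,
    ((λ y → ⇔-sym (imf≐ y)) , (λ x → ⇔-sym (closed-g x)) , (λ _ _ _ → refl))
    where
    img≐ = to orthoclosed-im⇔im≐kerᗮ closed-g
    imf≐ = to ᵒ.orthoclosed-im⇔im≐kerᗮ closed-f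

proposition4p4 : {a ℓa b ℓb : Level} (X : Orthoset a ℓa) (Y : Orthoset b ℓb)
    (f : Carrier X → Carrier Y) (g : Carrier Y → Carrier X) (adj : IsAdjoint X Y f g) →
    (Conditions.CondA X Y f g adj ⇔ Conditions.CondB X Y f g adj) ×
    (Conditions.CondB X Y f g adj ⇔ Conditions.CondC X Y f g adj) ×
    (Conditions.CondC X Y f g adj ⇔ Conditions.CondD X Y f g adj) ×
    (Conditions.CondA X Y f g adj → Conditions.Coincide X Y f g adj)
proposition4p4 X Y f g adj =
  ⇔-trans A⇔inverse (⇔-trans (⇔-sym D⇔inverse) (⇔-sym B⇔D)) ,
  ⇔-trans B⇔D (⇔-trans D⇔inverse (⇔-sym C⇔inverse)) ,
  ⇔-trans C⇔inverse (⇔-sym D⇔inverse) ,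
  D⇒coincide ∘ from D⇔inverse ∘ to A⇔inverse
  where open Equivalences X Y f g adj
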